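{- Let $q,r\ge 2$ be integers with $q\le r-1$, and let $H$ be a hypergraph. Let $\sigma$ assign independently to each vertex $v\in V(H)$ either one of the numbers in $\{q+1,\dots,r\}$, each with probability $1/r$, or the symbol $*$, with probability $q/r$. Let $H_\sigma$ be the multihypergraph on vertex set $\sigma^{ -1}(*)$ with edge multiset $\{e\cap\sigma^{ -1}(*): e\in E(H),\ |e\cap\sigma^{ -1}(j)|\ge 1\text{ for all }j\in[q+1,r]\}$. Then $H$ has an $r$-cut of surplus at least $\mathbb E_\sigma[\mathrm{surp}_q(H_\sigma)]$.
   Context: For a multihypergraph, an $r$-cut is a partition of its vertex set into $r$ parts; its size is the number of edges (with multiplicity) having at least one vertex in each part; its surplus is its size minus the expected size of a uniformly random $r$-cut (each vertex independently uniformly in one of the $r$ parts). $\mathrm{surp}_q$ denotes the maximum surplus of a $q$-cut. -}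

module Defs where

open import Data.Bool using (Bool; true; false; if_then_else_)
open import Data.Nat as ℕ using (ℕ; zero; suc; _∸_; NonZero)
open import Data.Integer using (+_)
open import Data.Fin using (Fin; zero; suc)
open import Data.Fin.Subset using (Subset)
open import Data.Maybe using (Maybe; just; nothing)
open import Data.List using (List; []; _∷_; map; concatMap; filter; length; lookup; allFin; foldr)
open import Data.Bool.ListAction using (all; any)
open import Data.Vec using (tabulate) renaming (lookup to vlookup)
open import Data.Rational using (ℚ; _/_; _+_; _*_; _-_; _⊔_; 0ℚ; 1ℚ)
open import Data.Fin.Properties using (_≟_)
open import Data.Maybe.Properties using (≡-dec)
open import Relation.Nullary.Decidable using (does; ⌊_⌋)
open import Function using (_∘_)

MultiHypergraph : ℕ → Set
MultiHypergraph n = List (Subset n)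

allFuns : {A : Set} → List A → (n : ℕ) → List (Fin n → A)
allFuns xs zero = (λ ()) ∷ []
allFuns xs (suc n) = concatMap (λ f → map (λ a → cons a f) xs) (allFuns xs n)
  where
  cons : _ → _ → _
  cons a f zero = a
  cons a f (suc i) = f i

Cut : ℕ → ℕ → Set
Cut n r = Fin n → Fin r

allCuts : (n r : ℕ) → List (Cut n r)
allCuts n r = allFuns (allFin r) n

isCut : {n r : ℕ} → Cut n r → Subset n → Bool
isCut {n} {r} f e =
  all (λ j → any (λ v → if vlookup e v then ⌊ f v ≟ j ⌋ else false) (allFin n)) (allFin r)

cutSize : {n r : ℕ} → MultiHypergraph n → Cut n r → ℕ
cutSize E f = length (filter (λ e → isCut f e ≟b true) E)
  where
  open import Data.Bool.Properties renaming (_≟_ to _≟b_)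

sumℚ : List ℚ → ℚ
sumℚ = foldr _+_ 0ℚ

avg : List ℚ → ℚ
avg [] = 0ℚ
avg (x ∷ xs) = sumℚ (x ∷ xs) * (+ 1 / suc (length xs))

toℚ : ℕ → ℚ
toℚ k = + k / 1

expectedCutSize : {n : ℕ} → (r : ℕ) → MultiHypergraph n → ℚ
expectedCutSize {n} r E = avg (map (λ f → toℚ (cutSize E f)) (allCuts n r))

surplus : {n r : ℕ} → MultiHypergraph n → Cut n r → ℚ
surplus {n} {r} E f = toℚ (cutSize E f) - expectedCutSize r E

maxList : List ℚ → ℚ
maxList [] = 0ℚ
maxList (x ∷ xs) = foldr _⊔_ x xs

surp : (q : ℕ) → {n : ℕ} → MultiHypergraph n → ℚ
surp q {n} E = maxList (map (surplus E) (allCuts n q))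

-- Labellings σ : V → {q+1,…,r} ∪ {*}.  'nothing' is *, 'just j' (j : Fin (r ∸ q))
-- stands for the number q+1+j.
Label : ℕ → ℕ → Set
Label q r = Maybe (Fin (r ∸ q))

allLabellings : (n q r : ℕ) → List (Fin n → Label q r)
allLabellings n q r = allFuns (nothing ∷ map just (allFin (r ∸ q))) n

labelProb : (q r : ℕ) → .{{NonZero r}} → Label q r → ℚ
labelProb q r nothing = + q / r
labelProb q r (just _) = + 1 / r

σProb : {n : ℕ} (q r : ℕ) → .{{NonZero r}} → (Fin n → Label q r) → ℚ
σProb {n} q r σ = foldr _*_ 1ℚ (map (labelProb q r ∘ σ) (allFin n))

isStar : (q r : ℕ) → Label q r → Bool
isStar q r nothing = true
isStar q r (just _) = false

-- σ⁻¹(*) as a list of vertices (in increasing order); H_σ lives on Fin (length of it)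
stars : {n : ℕ} (q r : ℕ) → (Fin n → Label q r) → List (Fin n)
stars {n} q r σ = filter (λ v → isStar q r (σ v) ≟b true) (allFin n)
  where
  open import Data.Bool.Properties renaming (_≟_ to _≟b_)

meetsAllNumbers : {n : ℕ} (q r : ℕ) → (Fin n → Label q r) → Subset n → Bool
meetsAllNumbers {n} q r σ e =
  all (λ j → any (λ v → if vlookup e v then does (≡-dec _≟_ (σ v) (just j)) else false) (allFin n))
      (allFin (r ∸ q))

-- e ∩ σ⁻¹(*), re-indexed along the enumeration of σ⁻¹(*)
restrictEdge : {n : ℕ} (q r : ℕ) → (σ : Fin n → Label q r) → Subset n → Subset (length (stars q r σ))
restrictEdge q r σ e = tabulate (λ i → vlookup e (lookup (stars q r σ) i))

Hσ : {n : ℕ} (q r : ℕ) → MultiHypergraph n → (σ : Fin n → Label q r) → MultiHypergraph (length (stars q r σ))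
Hσ q r H σ = map (restrictEdge q r σ) (filter (λ e → meetsAllNumbers q r σ e ≟b true) H)
  where
  open import Data.Bool.Properties renaming (_≟_ to _≟b_)

expectedSurpHσ : {n : ℕ} (q r : ℕ) → .{{NonZero r}} → MultiHypergraph n → ℚ
expectedSurpHσ {n} q r H = sumℚ (map (λ σ → σProb q r σ * surp q (Hσ q r H σ)) (allLabellings n q r))

-- Draw σ and, independently, a uniform q-cut h of all vertices; put each starred vertex v into
-- part h(v) ∈ [1, q] and each vertex labelled j ∈ [q+1, r] into part j. Every vertex then lands in
-- each of the r parts with probability 1/r, so this is a uniformly random r-cut; and it cuts an
-- edge exactly when the edge meets every σ⁻¹(j) and h cuts its starred part, i.e. when h restricted
-- to σ⁻¹(*) cuts the corresponding edge of H_σ. Hence E_σ of the expected q-cut size of H_σ is the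
-- expected r-cut size of H. Merging, for each σ, an optimal q-cut of H_σ with σ therefore gives
-- r-cuts of H whose surplus averages to E_σ[surp_q(H_σ)], so one of them has at least that surplus.
module Submission where

open import Data.Bool using (Bool; true; false; T; _∧_; if_then_else_)
open import Data.Bool.ListAction using (all; any)
open import Data.Bool.Properties using (T-∧) renaming (_≟_ to _≟ᵇ_)
open import Data.Empty using (⊥-elim)
open import Data.Fin as Fin using (Fin; zero; suc; cast; _↑ˡ_; _↑ʳ_; splitAt; join)
import Data.Fin.Properties as Fin
open import Data.Fin.Subset using (Subset)
open import Data.Integer as ℤ using (+_)
import Data.Integer.Properties as ℤ
import Data.Integer.Solver as ℤ-Solver
open import Data.List using (List; []; _∷_; _++_; map; concatMap; filter; length; lookup; tabulate; allFin; foldr)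
import Data.List.Properties as List
open import Data.List.Membership.Propositional using (_∈_; lose)
open import Data.List.Membership.Propositional.Properties using (∈-allFin; ∈-filter⁺; ∈-filter⁻; ∈-lookup)
import Data.List.Relation.Unary.All as All
open import Data.List.Relation.Unary.All.Properties using (all⁺; all⁻)
import Data.List.Relation.Unary.Any as Any
open import Data.List.Relation.Unary.Any.Properties using (lookup-index; any⁺; any⁻)
open import Data.List.Relation.Unary.Unique.Propositional using (Unique)
open import Data.Maybe using (just; nothing)
open import Data.Maybe.Properties using (≡-dec)
open import Data.Nat as ℕ using (ℕ; zero; suc; _∸_)
import Data.Nat.Properties as ℕ
open import Data.Product using (∃; ∃₂; _×_; _,_; proj₁; proj₂)
open import Data.Rational
open import Data.Rational.Properties
import Data.Rational.Solver as ℚ-Solver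
open import Data.Rational.Unnormalised as ℚᵘ using (ℚᵘ; *≡*) renaming (_/_ to _/ᵘ_)
import Data.Rational.Unnormalised.Properties as ℚᵘ
open import Data.Sum using (_⊎_; inj₁; inj₂)
open import Data.Vec using () renaming (lookup to vlookup)
import Data.Vec.Properties as Vec
open import Data.Vec.Functional using (zipWith) renaming (_∷_ to _∷ᶠ_)
open import Algebra.Definitions.RawSemiring +-*-rawSemiring using (_^_)
open import Function using (_∘_; id; _⇔_; mk⇔; Equivalence)
open import Function.Definitions using (Congruent)
open import Relation.Binary.PropositionalEquality
open import Relation.Nullary using (Dec; yes; no; does)
open import Relation.Nullary.Decidable using (isYes; isYes≗does)
open import Relation.Unary using (Pred; Decidable)

open import Defs

private
  variable
    A X : Set
    m n s : ℕ

fromℚᵘ-homo-+ : ∀ p q → fromℚᵘ (p ℚᵘ.+ q) ≡ fromℚᵘ p + fromℚᵘ q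
fromℚᵘ-homo-+ p q = toℚᵘ-injective (ℚᵘ.≃-trans (toℚᵘ-fromℚᵘ (p ℚᵘ.+ q)) (ℚᵘ.≃-sym
  (ℚᵘ.≃-trans (toℚᵘ-homo-+ (fromℚᵘ p) (fromℚᵘ q)) (ℚᵘ.+-cong (toℚᵘ-fromℚᵘ p) (toℚᵘ-fromℚᵘ q)))))

fromℚᵘ-homo-* : ∀ p q → fromℚᵘ (p ℚᵘ.* q) ≡ fromℚᵘ p * fromℚᵘ q
fromℚᵘ-homo-* p q = toℚᵘ-injective (ℚᵘ.≃-trans (toℚᵘ-fromℚᵘ (p ℚᵘ.* q)) (ℚᵘ.≃-sym
  (ℚᵘ.≃-trans (toℚᵘ-homo-* (fromℚᵘ p) (fromℚᵘ q)) (ℚᵘ.*-cong (toℚᵘ-fromℚᵘ p) (toℚᵘ-fromℚᵘ q)))))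

-- toℚ a and + a / suc d are fromℚᵘ of unnormalised fractions, so these identities come down
-- to cross-multiplication in ℤ.
module _ where
  open ℤ-Solver.+-*-Solver using (solve; _:+_; _:*_; _:=_; con)

  toℚ-+ : ∀ a b → toℚ (a ℕ.+ b) ≡ toℚ a + toℚ b
  toℚ-+ a b = trans (fromℚᵘ-cong {+ (a ℕ.+ b) /ᵘ 1} {a′ ℚᵘ.+ b′} (*≡* cross)) (fromℚᵘ-homo-+ a′ b′)
    where
    a′ b′ : ℚᵘ
    a′ = + a /ᵘ 1
    b′ = + b /ᵘ 1
    cross : + (a ℕ.+ b) ℤ.* (+ 1 ℤ.* + 1) ≡ (+ a ℤ.* + 1 ℤ.+ + b ℤ.* + 1) ℤ.* + 1
    cross rewrite ℤ.pos-+ a b =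
      solve 2 (λ x y → (x :+ y) :* (con (+ 1) :* con (+ 1)) := (x :* con (+ 1) :+ y :* con (+ 1)) :* con (+ 1))
              refl (+ a) (+ b)

  toℚ-* : ∀ a b → toℚ (a ℕ.* b) ≡ toℚ a * toℚ b
  toℚ-* a b = trans (fromℚᵘ-cong {+ (a ℕ.* b) /ᵘ 1} {a′ ℚᵘ.* b′} (*≡* cross)) (fromℚᵘ-homo-* a′ b′)
    where
    a′ b′ : ℚᵘ
    a′ = + a /ᵘ 1
    b′ = + b /ᵘ 1
    cross : + (a ℕ.* b) ℤ.* (+ 1 ℤ.* + 1) ≡ (+ a ℤ.* + b) ℤ.* + 1
    cross = trans (cong (ℤ._* (+ 1 ℤ.* + 1)) (ℤ.pos-* a b))
      (solve 2 (λ x y → (x :* y) :* (con (+ 1) :* con (+ 1)) := (x :* y) :* con (+ 1)) refl (+ a) (+ b))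

  /≡toℚ*1/ : ∀ a d → + a / suc d ≡ toℚ a * (+ 1 / suc d)
  /≡toℚ*1/ a d = trans (fromℚᵘ-cong {+ a /ᵘ suc d} {a′ ℚᵘ.* 1/d′} (*≡* cross)) (fromℚᵘ-homo-* a′ 1/d′)
    where
    a′ 1/d′ : ℚᵘ
    a′ = + a /ᵘ 1
    1/d′ = + 1 /ᵘ suc d
    cross : + a ℤ.* (+ 1 ℤ.* + suc d) ≡ (+ a ℤ.* + 1) ℤ.* + suc d
    cross = solve 2 (λ x y → x :* (con (+ 1) :* y) := (x :* con (+ 1)) :* y) refl (+ a) (+ suc d)

  1/*toℚ≡1 : ∀ d → + 1 / suc d * toℚ (suc d) ≡ 1ℚ
  1/*toℚ≡1 d = trans (sym (fromℚᵘ-homo-* 1/d′ d′)) (fromℚᵘ-cong {1/d′ ℚᵘ.* d′} {+ 1 /ᵘ 1} (*≡* cross))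
    where
    d′ 1/d′ : ℚᵘ
    d′ = + suc d /ᵘ 1
    1/d′ = + 1 /ᵘ suc d
    cross : (+ 1 ℤ.* + suc d) ℤ.* + 1 ≡ + 1 ℤ.* (+ suc d ℤ.* + 1)
    cross = solve 1 (λ x → (con (+ 1) :* x) :* con (+ 1) := con (+ 1) :* (x :* con (+ 1))) refl (+ suc d)

open ℚ-Solver.+-*-Solver

toℚ-^ : ∀ a n → toℚ (a ℕ.^ n) ≡ toℚ a ^ n
toℚ-^ a zero = refl
toℚ-^ a (suc n) = trans (toℚ-* a (a ℕ.^ n)) (cong (toℚ a *_) (toℚ-^ a n))

*≡1⇒^*^≡1 : ∀ {x y} → x * y ≡ 1ℚ → ∀ n → x ^ n * y ^ n ≡ 1ℚ
*≡1⇒^*^≡1 x*y≡1 zero = refl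
*≡1⇒^*^≡1 {x} {y} x*y≡1 (suc n) = begin
  (x * x ^ n) * (y * y ^ n)  ≡⟨ solve 4 (λ x y u v → (x :* u) :* (y :* v) := (x :* y) :* (u :* v)) refl x y (x ^ n) (y ^ n) ⟩
  (x * y) * (x ^ n * y ^ n)  ≡⟨ cong₂ _*_ x*y≡1 (*≡1⇒^*^≡1 x*y≡1 n) ⟩
  1ℚ                         ∎
  where open ≡-Reasoning

length*avg≡sum : (xs : List ℚ) → toℚ (length xs) * avg xs ≡ sumℚ xs
length*avg≡sum []       = *-zeroʳ 0ℚ
length*avg≡sum (x ∷ xs) = begin
  l * (sumℚ (x ∷ xs) * 1/l)   ≡⟨ solve 3 (λ l s u → l :* (s :* u) := s :* (u :* l)) refl l (sumℚ (x ∷ xs)) 1/l ⟩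
  sumℚ (x ∷ xs) * (1/l * l)   ≡⟨ cong (sumℚ (x ∷ xs) *_) (1/*toℚ≡1 (length xs)) ⟩
  sumℚ (x ∷ xs) * 1ℚ          ≡⟨ *-identityʳ _ ⟩
  sumℚ (x ∷ xs)               ∎
  where
  open ≡-Reasoning
  l 1/l : ℚ
  l = toℚ (suc (length xs))
  1/l = + 1 / suc (length xs)

length-allFin : ∀ n → length (allFin n) ≡ n
length-allFin n = List.length-tabulate {n = n} id

1/suc*length-allFin≡1 : ∀ d → + 1 / suc d * toℚ (length (allFin (suc d))) ≡ 1ℚ
1/suc*length-allFin≡1 d = trans (cong (λ l → + 1 / suc d * toℚ l) (length-allFin (suc d))) (1/*toℚ≡1 d)

∑ : List X → (X → ℚ) → ℚ
∑ xs F = sumℚ (map F xs)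

infixr 9 ∑
syntax ∑ xs (λ x → F) = ∑[ x ∈ xs ] F

∑-cong : (xs : List X) {F G : X → ℚ} → (∀ x → F x ≡ G x) → ∑ xs F ≡ ∑ xs G
∑-cong []       F≗G = refl
∑-cong (x ∷ xs) F≗G = cong₂ _+_ (F≗G x) (∑-cong xs F≗G)

∑-++ : (xs ys : List X) (F : X → ℚ) → ∑ (xs ++ ys) F ≡ ∑ xs F + ∑ ys F
∑-++ []       ys F = sym (+-identityˡ _)
∑-++ (x ∷ xs) ys F = trans (cong (_+_ (F x)) (∑-++ xs ys F)) (sym (+-assoc (F x) _ _))

∑-map : (g : X → A) (xs : List X) (F : A → ℚ) → ∑ (map g xs) F ≡ ∑ xs (F ∘ g)
∑-map g []       F = refl
∑-map g (x ∷ xs) F = cong (_+_ (F (g x))) (∑-map g xs F)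

∑-concatMap : (g : X → List A) (xs : List X) (F : A → ℚ) → ∑ (concatMap g xs) F ≡ ∑[ x ∈ xs ] ∑ (g x) F
∑-concatMap g []       F = refl
∑-concatMap g (x ∷ xs) F = trans (∑-++ (g x) (concatMap g xs) F) (cong (_+_ (∑ (g x) F)) (∑-concatMap g xs F))

∑-*ˡ : (xs : List X) (c : ℚ) (F : X → ℚ) → ∑[ x ∈ xs ] (c * F x) ≡ c * ∑ xs F
∑-*ˡ []       c F = sym (*-zeroʳ c)
∑-*ˡ (x ∷ xs) c F = trans (cong (_+_ (c * F x)) (∑-*ˡ xs c F)) (sym (*-distribˡ-+ c (F x) _))

∑-+ : (xs : List X) (F G : X → ℚ) → ∑[ x ∈ xs ] (F x + G x) ≡ ∑ xs F + ∑ xs G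
∑-+ []       F G = refl
∑-+ (x ∷ xs) F G = trans (cong (_+_ (F x + G x)) (∑-+ xs F G))
  (solve 4 (λ a b c d → (a :+ b) :+ (c :+ d) := (a :+ c) :+ (b :+ d)) refl (F x) (G x) (∑ xs F) (∑ xs G))

∑-- : (xs : List X) (F G : X → ℚ) → ∑[ x ∈ xs ] (F x - G x) ≡ ∑ xs F - ∑ xs G
∑-- []       F G = refl
∑-- (x ∷ xs) F G = trans (cong (_+_ (F x - G x)) (∑-- xs F G))
  (solve 4 (λ a b c d → (a :- b) :+ (c :- d) := (a :+ c) :- (b :+ d)) refl (F x) (G x) (∑ xs F) (∑ xs G))

∑-const : (xs : List X) (c : ℚ) → ∑[ x ∈ xs ] c ≡ toℚ (length xs) * c
∑-const []       c = sym (*-zeroˡ c)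
∑-const (x ∷ xs) c = begin
  c + ∑[ x ∈ xs ] c                ≡⟨ cong (_+_ c) (∑-const xs c) ⟩
  c + toℚ (length xs) * c          ≡⟨ solve 2 (λ c t → c :+ t :* c := (con 1ℚ :+ t) :* c) refl c (toℚ (length xs)) ⟩
  (1ℚ + toℚ (length xs)) * c       ≡⟨ cong (_* c) (toℚ-+ 1 (length xs)) ⟨
  toℚ (suc (length xs)) * c        ∎
  where open ≡-Reasoning

∑-swap : (xs : List X) (ys : List A) (F : X → A → ℚ) →
         ∑[ x ∈ xs ] ∑[ y ∈ ys ] F x y ≡ ∑[ y ∈ ys ] ∑[ x ∈ xs ] F x y
∑-swap []       ys F = trans (sym (*-zeroʳ (toℚ (length ys)))) (sym (∑-const ys 0ℚ))
∑-swap (x ∷ xs) ys F = trans (cong (_+_ (∑ ys (F x))) (∑-swap xs ys F)) (sym (∑-+ ys (F x) _))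

∑-nonNeg : (xs : List X) (F : X → ℚ) → (∀ x → 0ℚ ≤ F x) → 0ℚ ≤ ∑ xs F
∑-nonNeg []       F F≥0 = ≤-refl
∑-nonNeg (x ∷ xs) F F≥0 = +-mono-≤ (F≥0 x) (∑-nonNeg xs F F≥0)

∑-tabulate : (f : Fin n → X) (F : X → ℚ) → ∑ (tabulate f) F ≡ ∑ (allFin n) (F ∘ f)
∑-tabulate f F = trans (cong sumℚ (List.map-tabulate f F)) (sym (cong sumℚ (List.map-tabulate id (F ∘ f))))

∑-allFin-+ : ∀ m k (G : Fin (m ℕ.+ k) → ℚ) →
             ∑ (allFin (m ℕ.+ k)) G ≡ ∑[ i ∈ allFin m ] G (i ↑ˡ k) + ∑[ j ∈ allFin k ] G (m ↑ʳ j)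
∑-allFin-+ zero    k G = sym (+-identityˡ _)
∑-allFin-+ (suc m) k G = begin
    G zero + ∑ (tabulate suc) G
  ≡⟨ cong (_+_ (G zero)) (∑-tabulate suc G) ⟩
    G zero + ∑ (allFin (m ℕ.+ k)) (G ∘ suc)
  ≡⟨ cong (_+_ (G zero)) (∑-allFin-+ m k (G ∘ suc)) ⟩
    G zero + (∑[ i ∈ allFin m ] G (suc (i ↑ˡ k)) + right)
  ≡⟨ +-assoc (G zero) _ right ⟨
    G zero + ∑[ i ∈ allFin m ] G (suc (i ↑ˡ k)) + right
  ≡⟨ cong (λ t → G zero + t + right) (∑-tabulate suc (G ∘ (_↑ˡ k))) ⟨
    ∑[ i ∈ allFin (suc m) ] G (i ↑ˡ k) + right
  ∎
  where
  open ≡-Reasoning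
  right : ℚ
  right = ∑[ j ∈ allFin k ] G (suc m ↑ʳ j)

∑-allFin-cast : (m≡n : m ≡ n) (G : Fin n → ℚ) → ∑ (allFin n) G ≡ ∑[ i ∈ allFin m ] G (cast m≡n i)
∑-allFin-cast refl G = ∑-cong (allFin _) λ i → cong G (sym (Fin.cast-is-id refl i))

product-nonNeg : (xs : List X) (f : X → ℚ) → (∀ x → 0ℚ ≤ f x) → 0ℚ ≤ foldr _*_ 1ℚ (map f xs)
product-nonNeg []       f f≥0 = *≤* (ℤ.+≤+ ℕ.z≤n)
product-nonNeg (x ∷ xs) f f≥0 = nonNegative⁻¹ _
  {{nonNeg*nonNeg⇒nonNeg (f x) {{nonNegative (f≥0 x)}} _ {{nonNegative (product-nonNeg xs f f≥0)}}}}

∃-weightedSum≤ : (x : X) (xs : List X) (p Y : X → ℚ) → (∀ z → 0ℚ ≤ p z) →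
                 ∃ λ y → ∑[ z ∈ x ∷ xs ] (p z * Y z) ≤ ∑ (x ∷ xs) p * Y y
∃-weightedSum≤ x [] p Y p≥0 =
  x , ≤-reflexive (solve 2 (λ a b → a :* b :+ con 0ℚ := (a :+ con 0ℚ) :* b) refl (p x) (Y x))
∃-weightedSum≤ x (x′ ∷ xs) p Y p≥0 with ∃-weightedSum≤ x′ xs p Y p≥0
... | y , ih with ≤-total (Y x) (Y y)
...   | inj₁ Yx≤Yy = y , (begin
        p x * Y x + ∑[ z ∈ x′ ∷ xs ] (p z * Y z)  ≤⟨ +-mono-≤ (*-monoˡ-≤-nonNeg (p x) {{nonNegative (p≥0 x)}} Yx≤Yy) ih ⟩
        p x * Y y + ∑ (x′ ∷ xs) p * Y y          ≡⟨ *-distribʳ-+ (Y y) (p x) (∑ (x′ ∷ xs) p) ⟨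
        (p x + ∑ (x′ ∷ xs) p) * Y y              ∎)
  where open ≤-Reasoning
...   | inj₂ Yy≤Yx = x , (begin
        p x * Y x + ∑[ z ∈ x′ ∷ xs ] (p z * Y z)  ≤⟨ +-monoʳ-≤ (p x * Y x) ih ⟩
        p x * Y x + ∑ (x′ ∷ xs) p * Y y          ≤⟨ +-monoʳ-≤ (p x * Y x) (*-monoˡ-≤-nonNeg (∑ (x′ ∷ xs) p)
                                                       {{nonNegative (∑-nonNeg (x′ ∷ xs) p p≥0)}} Yy≤Yx) ⟩
        p x * Y x + ∑ (x′ ∷ xs) p * Y x          ≡⟨ *-distribʳ-+ (Y x) (p x) (∑ (x′ ∷ xs) p) ⟨
        (p x + ∑ (x′ ∷ xs) p) * Y x              ∎)
  where open ≤-Reasoning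

∃-weightedMean≤ : (zs : List X) (p Y : X → ℚ) → (∀ z → 0ℚ ≤ p z) → ∑ zs p ≡ 1ℚ →
                  ∃ λ y → ∑[ z ∈ zs ] (p z * Y z) ≤ Y y
∃-weightedMean≤ []       p Y p≥0 ()
∃-weightedMean≤ (x ∷ xs) p Y p≥0 ∑p≡1 with ∃-weightedSum≤ x xs p Y p≥0
... | y , bound = y , ≤-trans bound (≤-reflexive (trans (cong (_* Y y) ∑p≡1) (*-identityˡ (Y y))))

maxList-map-attained : (φ : X → ℚ) (x : X) (xs : List X) → ∃ λ y → maxList (map φ (x ∷ xs)) ≡ φ y
maxList-map-attained φ x []        = x , refl
maxList-map-attained φ x (x′ ∷ xs) with maxList-map-attained φ x xs
... | y , ih with ≤-total (φ x′) (φ y)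
...   | inj₁ φx′≤φy = y  , trans (cong (φ x′ ⊔_) ih) (p≤q⇒p⊔q≡q φx′≤φy)
...   | inj₂ φy≤φx′ = x′ , trans (cong (φ x′ ⊔_) ih) (p≥q⇒p⊔q≡p φy≤φx′)

∷ᶠ-cong : (a : A) {f g : Fin n → A} → f ≗ g → (a ∷ᶠ f) ≗ (a ∷ᶠ g)
∷ᶠ-cong a f≗g zero    = refl
∷ᶠ-cong a f≗g (suc i) = f≗g i

-- allFuns extends functions by a cons local to Defs, which agrees with _∷ᶠ_ only pointwise;
-- hence the congruence hypotheses on summands.
∑-allFuns-suc : (xs : List A) (n : ℕ) (F : (Fin (suc n) → A) → ℚ) → Congruent _≗_ _≡_ F →
                ∑ (allFuns xs (suc n)) F ≡ ∑[ f ∈ allFuns xs n ] ∑[ a ∈ xs ] F (a ∷ᶠ f)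
∑-allFuns-suc xs n F F-cong = trans (∑-concatMap _ (allFuns xs n) F) (∑-cong (allFuns xs n) λ f →
  trans (∑-map _ xs F) (∑-cong xs λ a → F-cong λ { zero → refl ; (suc i) → refl }))

length-allFuns : (xs : List A) (n : ℕ) → length (allFuns xs n) ≡ length xs ℕ.^ n
length-allFuns xs zero    = refl
length-allFuns {A = A} xs (suc n) =
  trans (length-concatMap _ (allFuns xs n)) (cong (length xs ℕ.*_) (length-allFuns xs n))
  where
  length-concatMap : (g : (Fin n → A) → A → Fin (suc n) → A) (fs : List (Fin n → A)) →
                     length (concatMap (λ f → map (g f) xs) fs) ≡ length xs ℕ.* length fs
  length-concatMap g []       = sym (ℕ.*-zeroʳ (length xs))
  length-concatMap g (f ∷ fs) = begin
    length (map (g f) xs ++ concatMap (λ f → map (g f) xs) fs)  ≡⟨ List.length-++ (map (g f) xs) ⟩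
    length (map (g f) xs) ℕ.+ length (concatMap (λ f → map (g f) xs) fs)
      ≡⟨ cong₂ ℕ._+_ (List.length-map (g f) xs) (length-concatMap g fs) ⟩
    length xs ℕ.+ length xs ℕ.* length fs                      ≡⟨ ℕ.*-suc (length xs) (length fs) ⟨
    length xs ℕ.* suc (length fs)                               ∎
    where open ≡-Reasoning

allFuns-nonEmpty : (a : A) (xs : List A) (n : ℕ) → ∃₂ λ f fs → allFuns (a ∷ xs) n ≡ f ∷ fs
allFuns-nonEmpty a xs zero = _ , _ , refl
allFuns-nonEmpty a xs (suc n) with allFuns-nonEmpty a xs n
... | f , fs , eq rewrite eq = _ , _ , refl

data Thinning : ℕ → ℕ → ℕ → Set where
  done : Thinning 0 0 0
  keep : Thinning m n s → Thinning (suc m) (suc n) s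
  skip : Thinning m n s → Thinning m (suc n) (suc s)

embed : Thinning m n s → Fin m → Fin n
embed (keep θ) zero    = zero
embed (keep θ) (suc i) = suc (embed θ i)
embed (skip θ) i       = suc (embed θ i)

extend : Thinning m n s → A → (Fin m → A) → Fin n → A
extend (keep θ) a g zero    = g zero
extend (keep θ) a g (suc v) = extend θ a (g ∘ suc) v
extend (skip θ) a g zero    = a
extend (skip θ) a g (suc v) = extend θ a g v

extend-embed : (θ : Thinning m n s) (a : A) (g : Fin m → A) → extend θ a g ∘ embed θ ≗ g
extend-embed (keep θ) a g zero    = refl
extend-embed (keep θ) a g (suc i) = extend-embed θ a (g ∘ suc) i
extend-embed (skip θ) a g i       = extend-embed θ a g i

filter-tabulate-thinning : ∀ {ℓ} {P : Pred X ℓ} (P? : Decidable P) (f : Fin n → X) →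
  ∃₂ λ k (θ : Thinning (length (filter P? (tabulate f))) n k) →
       ∀ i → lookup (filter P? (tabulate f)) i ≡ f (embed θ i)
filter-tabulate-thinning {n = zero}  P? f = 0 , done , λ ()
filter-tabulate-thinning {n = suc n} P? f with does (P? (f zero)) | filter-tabulate-thinning P? (f ∘ suc)
... | true  | k , θ , lookup≡ = k , keep θ , λ { zero → refl ; (suc i) → lookup≡ i }
... | false | k , θ , lookup≡ = suc k , skip θ , lookup≡

record FilterThinning {ℓ} {n : ℕ} {P : Pred (Fin n) ℓ} (P? : Decidable P) : Set ℓ where
  field
    skipped       : ℕ
    thinning      : Thinning (length (filter P? (allFin n))) n skipped
    lookup-filter : ∀ i → lookup (filter P? (allFin n)) i ≡ embed thinning i

  embed-sound : ∀ i → P (embed thinning i)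
  embed-sound i = subst P (lookup-filter i) (proj₂ (∈-filter⁻ P? {xs = allFin n} (∈-lookup i)))

  embed-complete : ∀ {v} → P v → ∃ λ i → embed thinning i ≡ v
  embed-complete {v} Pv = Any.index v∈ , trans (sym (lookup-filter (Any.index v∈))) (sym (lookup-index v∈))
    where
    v∈ : v ∈ filter P? (allFin n)
    v∈ = ∈-filter⁺ P? (∈-allFin v) Pv

filterThinning : ∀ {ℓ} {P : Pred (Fin n) ℓ} (P? : Decidable P) → FilterThinning P?
filterThinning P? = let k , θ , lookup≡ = filter-tabulate-thinning P? id
                    in record { skipped = k ; thinning = θ ; lookup-filter = lookup≡ }

-- With α = 1/|xs|, α ^ n * ∑ (allFuns xs n) F is the mean of F over uniform f : Fin n → xs.
module _ (α : ℚ) (xs : List A) (α*length≡1 : α * toℚ (length xs) ≡ 1ℚ) where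

  ^*length-allFuns≡1 : ∀ n → α ^ n * toℚ (length (allFuns xs n)) ≡ 1ℚ
  ^*length-allFuns≡1 n = begin
    α ^ n * toℚ (length (allFuns xs n))  ≡⟨ cong (λ l → α ^ n * toℚ l) (length-allFuns xs n) ⟩
    α ^ n * toℚ (length xs ℕ.^ n)        ≡⟨ cong (α ^ n *_) (toℚ-^ (length xs) n) ⟩
    α ^ n * toℚ (length xs) ^ n          ≡⟨ *≡1⇒^*^≡1 α*length≡1 n ⟩
    1ℚ                                   ∎
    where open ≡-Reasoning

  avg-allFuns : ∀ n (F : (Fin n → A) → ℚ) → avg (map F (allFuns xs n)) ≡ α ^ n * ∑ (allFuns xs n) F
  avg-allFuns n F = begin
    avg Fs                                   ≡⟨ *-identityˡ _ ⟨
    1ℚ * avg Fs                              ≡⟨ cong (_* avg Fs) (^*length-allFuns≡1 n) ⟨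
    α ^ n * toℚ (length fs) * avg Fs         ≡⟨ *-assoc (α ^ n) _ _ ⟩
    α ^ n * (toℚ (length fs) * avg Fs)       ≡⟨ cong (λ l → α ^ n * (toℚ l * avg Fs)) (List.length-map F fs) ⟨
    α ^ n * (toℚ (length Fs) * avg Fs)       ≡⟨ cong (α ^ n *_) (length*avg≡sum Fs) ⟩
    α ^ n * ∑ fs F                           ∎
    where
    open ≡-Reasoning
    fs : List (Fin n → A)
    fs = allFuns xs n
    Fs : List ℚ
    Fs = map F fs

  ^*∑-allFuns-1≡1 : ∀ n → α ^ n * ∑[ f ∈ allFuns xs n ] 1ℚ ≡ 1ℚ
  ^*∑-allFuns-1≡1 n =
    trans (cong (α ^ n *_) (trans (∑-const (allFuns xs n) 1ℚ) (*-identityʳ _))) (^*length-allFuns≡1 n)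

  ∑-allFuns-∘embed : (θ : Thinning m n s) (G : (Fin m → A) → ℚ) → Congruent _≗_ _≡_ G →
                     α ^ n * ∑[ h ∈ allFuns xs n ] G (h ∘ embed θ) ≡ α ^ m * ∑ (allFuns xs m) G
  ∑-allFuns-∘embed done G G-cong = cong (λ t → 1ℚ * (t + 0ℚ)) (G-cong λ ())
  ∑-allFuns-∘embed {m = suc m} {n = suc n} (keep θ) G G-cong = begin
      α * α ^ n * ∑[ h ∈ allFuns xs (suc n) ] G (h ∘ embed (keep θ))
    ≡⟨ cong (α * α ^ n *_) (∑-allFuns-suc xs n _ (λ h≗h′ → G-cong (h≗h′ ∘ embed (keep θ)))) ⟩
      α * α ^ n * ∑[ h ∈ allFuns xs n ] ∑[ a ∈ xs ] G ((a ∷ᶠ h) ∘ embed (keep θ))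
    ≡⟨ cong (α * α ^ n *_) (∑-cong (allFuns xs n) λ h → ∑-cong xs λ a → G-cong λ { zero → refl ; (suc i) → refl }) ⟩
      α * α ^ n * ∑[ h ∈ allFuns xs n ] G̃ (h ∘ embed θ)
    ≡⟨ *-assoc α _ _ ⟩
      α * (α ^ n * ∑[ h ∈ allFuns xs n ] G̃ (h ∘ embed θ))
    ≡⟨ cong (α *_) (∑-allFuns-∘embed θ G̃ G̃-cong) ⟩
      α * (α ^ m * ∑ (allFuns xs m) G̃)
    ≡⟨ *-assoc α _ _ ⟨
      α * α ^ m * ∑ (allFuns xs m) G̃
    ≡⟨ cong (α * α ^ m *_) (∑-allFuns-suc xs m G G-cong) ⟨
      α * α ^ m * ∑ (allFuns xs (suc m)) G
    ∎
    where
    open ≡-Reasoning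
    G̃ : (Fin m → A) → ℚ
    G̃ g = ∑[ a ∈ xs ] G (a ∷ᶠ g)
    G̃-cong : Congruent _≗_ _≡_ G̃
    G̃-cong g≗g′ = ∑-cong xs λ a → G-cong (∷ᶠ-cong a g≗g′)
  ∑-allFuns-∘embed {m = m} {n = suc n} (skip θ) G G-cong = begin
      α * α ^ n * ∑[ h ∈ allFuns xs (suc n) ] G (h ∘ embed (skip θ))
    ≡⟨ cong (α * α ^ n *_) (∑-allFuns-suc xs n _ (λ h≗h′ → G-cong (h≗h′ ∘ embed (skip θ)))) ⟩
      α * α ^ n * ∑[ h ∈ allFuns xs n ] ∑[ a ∈ xs ] G (h ∘ embed θ)
    ≡⟨ cong (α * α ^ n *_) (∑-cong (allFuns xs n) λ h → ∑-const xs (G (h ∘ embed θ))) ⟩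
      α * α ^ n * ∑[ h ∈ allFuns xs n ] (toℚ (length xs) * G (h ∘ embed θ))
    ≡⟨ cong (α * α ^ n *_) (∑-*ˡ (allFuns xs n) (toℚ (length xs)) _) ⟩
      α * α ^ n * (toℚ (length xs) * S)
    ≡⟨ solve 4 (λ a u l s → a :* u :* (l :* s) := a :* l :* (u :* s)) refl α (α ^ n) (toℚ (length xs)) S ⟩
      α * toℚ (length xs) * (α ^ n * S)
    ≡⟨ trans (cong (_* (α ^ n * S)) α*length≡1) (*-identityˡ _) ⟩
      α ^ n * S
    ≡⟨ ∑-allFuns-∘embed θ G G-cong ⟩
      α ^ m * ∑ (allFuns xs m) G
    ∎
    where
    open ≡-Reasoning
    S : ℚ
    S = ∑[ h ∈ allFuns xs n ] G (h ∘ embed θ)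

-- Read with α = 1/|bs| and β = 1/|as|: if l drawn with weight p and an independent uniform b make
-- part l b uniform on as, then σ drawn with the product weights and an independent uniform h make
-- zipWith part σ h uniform on Fin n → as.
module Tensorisation {L B A : Set} (ls : List L) (bs : List B) (as : List A)
  (p : L → ℚ) (part : L → B → A) (α β : ℚ)
  (part-uniform : ∀ G → ∑[ l ∈ ls ] (p l * (α * ∑[ b ∈ bs ] G (part l b))) ≡ β * ∑ as G) where

  productWeight : (Fin n → L) → ℚ
  productWeight {n} σ = foldr _*_ 1ℚ (map (p ∘ σ) (allFin n))

  productWeight-cong : {σ τ : Fin n → L} → σ ≗ τ → productWeight σ ≡ productWeight τ
  productWeight-cong σ≗τ = cong (foldr _*_ 1ℚ) (List.map-cong (cong p ∘ σ≗τ) (allFin _))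

  productWeight-∷ : (l : L) (σ : Fin n → L) → productWeight (l ∷ᶠ σ) ≡ p l * productWeight σ
  productWeight-∷ l σ = cong (λ ws → p l * foldr _*_ 1ℚ ws)
    (trans (List.map-tabulate suc (p ∘ (l ∷ᶠ σ))) (sym (List.map-tabulate id (p ∘ σ))))

  weightedMean : ∀ n → ((Fin n → A) → ℚ) → (Fin n → L) → ℚ
  weightedMean n F σ = productWeight σ * (α ^ n * ∑[ h ∈ allFuns bs n ] F (zipWith part σ h))

  weightedMean-cong : ∀ n (F : (Fin n → A) → ℚ) → Congruent _≗_ _≡_ F →
                      Congruent _≗_ _≡_ (weightedMean n F)
  weightedMean-cong n F F-cong σ≗τ = cong₂ _*_ (productWeight-cong σ≗τ)
    (cong (α ^ n *_) (∑-cong (allFuns bs n) λ h → F-cong λ v → cong (λ l → part l (h v)) (σ≗τ v)))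

  weightedMean-∷ : ∀ n (F : (Fin (suc n) → A) → ℚ) → Congruent _≗_ _≡_ F → (σ : Fin n → L) →
                   ∑[ l ∈ ls ] weightedMean (suc n) F (l ∷ᶠ σ)
                   ≡ β * weightedMean n (λ f → ∑[ a ∈ as ] F (a ∷ᶠ f)) σ
  weightedMean-∷ n F F-cong σ = begin
      ∑[ l ∈ ls ] weightedMean (suc n) F (l ∷ᶠ σ)
    ≡⟨ ∑-cong ls (λ l → cong₂ _*_ (productWeight-∷ l σ) (cong (α * α ^ n *_) (unfold-h l))) ⟩
      ∑[ l ∈ ls ] (p l * W * (α * α ^ n * ∑[ h ∈ hs ] Φ l h))
    ≡⟨ ∑-cong ls (λ l → trans (regroup (p l) (∑[ h ∈ hs ] Φ l h))
                              (cong (W * α ^ n *_) (sym (pull-out l)))) ⟩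
      ∑[ l ∈ ls ] (W * α ^ n * ∑[ h ∈ hs ] (p l * (α * Φ l h)))
    ≡⟨ ∑-*ˡ ls (W * α ^ n) _ ⟩
      W * α ^ n * ∑[ l ∈ ls ] ∑[ h ∈ hs ] (p l * (α * Φ l h))
    ≡⟨ cong (W * α ^ n *_) (∑-swap ls hs _) ⟩
      W * α ^ n * ∑[ h ∈ hs ] ∑[ l ∈ ls ] (p l * (α * Φ l h))
    ≡⟨ cong (W * α ^ n *_) (∑-cong hs λ h → part-uniform λ a → F (a ∷ᶠ zipWith part σ h)) ⟩
      W * α ^ n * ∑[ h ∈ hs ] (β * F̃ (zipWith part σ h))
    ≡⟨ cong (W * α ^ n *_) (∑-*ˡ hs β _) ⟩
      W * α ^ n * (β * ∑[ h ∈ hs ] F̃ (zipWith part σ h))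
    ≡⟨ solve 4 (λ w u b s → w :* u :* (b :* s) := b :* (w :* (u :* s))) refl W (α ^ n) β _ ⟩
      β * weightedMean n F̃ σ
    ∎
    where
    open ≡-Reasoning
    W : ℚ
    W = productWeight σ
    hs : List (Fin n → B)
    hs = allFuns bs n
    Φ : L → (Fin n → B) → ℚ
    Φ l h = ∑[ b ∈ bs ] F (part l b ∷ᶠ zipWith part σ h)
    F̃ : (Fin n → A) → ℚ
    F̃ f = ∑[ a ∈ as ] F (a ∷ᶠ f)
    unfold-h : ∀ l → ∑[ h ∈ allFuns bs (suc n) ] F (zipWith part (l ∷ᶠ σ) h) ≡ ∑[ h ∈ hs ] Φ l h
    unfold-h l = trans (∑-allFuns-suc bs n _ λ h≗h′ → F-cong λ v → cong (part ((l ∷ᶠ σ) v)) (h≗h′ v))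
      (∑-cong hs λ h → ∑-cong bs λ b → F-cong λ { zero → refl ; (suc v) → refl })
    regroup : ∀ x s → x * W * (α * α ^ n * s) ≡ W * α ^ n * (x * (α * s))
    regroup x s = solve 5 (λ x w a u s → x :* w :* (a :* u :* s) := w :* u :* (x :* (a :* s))) refl x W α (α ^ n) s
    pull-out : ∀ l → ∑[ h ∈ hs ] (p l * (α * Φ l h)) ≡ p l * (α * ∑[ h ∈ hs ] Φ l h)
    pull-out l = trans (∑-*ˡ hs (p l) _) (cong (p l *_) (∑-*ˡ hs α (Φ l)))

  tensorise : ∀ n (F : (Fin n → A) → ℚ) → Congruent _≗_ _≡_ F →
              ∑[ σ ∈ allFuns ls n ] weightedMean n F σ ≡ β ^ n * ∑ (allFuns as n) F
  tensorise zero F F-cong =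
    trans (+-identityʳ _) (trans (*-identityˡ _) (cong (λ t → 1ℚ * (t + 0ℚ)) (F-cong λ ())))
  tensorise (suc n) F F-cong = begin
      ∑ (allFuns ls (suc n)) (weightedMean (suc n) F)
    ≡⟨ ∑-allFuns-suc ls n _ (weightedMean-cong (suc n) F F-cong) ⟩
      ∑[ σ ∈ allFuns ls n ] ∑[ l ∈ ls ] weightedMean (suc n) F (l ∷ᶠ σ)
    ≡⟨ ∑-cong (allFuns ls n) (weightedMean-∷ n F F-cong) ⟩
      ∑[ σ ∈ allFuns ls n ] (β * weightedMean n F̃ σ)
    ≡⟨ ∑-*ˡ (allFuns ls n) β _ ⟩
      β * ∑ (allFuns ls n) (weightedMean n F̃)
    ≡⟨ cong (β *_) (tensorise n F̃ F̃-cong) ⟩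
      β * (β ^ n * ∑ (allFuns as n) F̃)
    ≡⟨ *-assoc β _ _ ⟨
      β * β ^ n * ∑ (allFuns as n) F̃
    ≡⟨ cong (β * β ^ n *_) (∑-allFuns-suc as n F F-cong) ⟨
      β * β ^ n * ∑ (allFuns as (suc n)) F
    ∎
    where
    open ≡-Reasoning
    F̃ : (Fin n → A) → ℚ
    F̃ f = ∑[ a ∈ as ] F (a ∷ᶠ f)
    F̃-cong : Congruent _≗_ _≡_ F̃
    F̃-cong f≗g = ∑-cong as λ a → F-cong (∷ᶠ-cong a f≗g)

T-injective : {x y : Bool} → T x ⇔ T y → x ≡ y
T-injective {false} {false} _   = refl
T-injective {false} {true}  x⇔y = ⊥-elim (Equivalence.from x⇔y _)
T-injective {true}  {false} x⇔y = ⊥-elim (Equivalence.to x⇔y _)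
T-injective {true}  {true}  _   = refl

T-if-does⇔ : {P : Set} (b : Bool) (P? : Dec P) → T (if b then does P? else false) ⇔ (T b × P)
T-if-does⇔ false P?       = mk⇔ (λ ()) (λ ())
T-if-does⇔ true  (yes p)  = mk⇔ (λ _ → _ , p) (λ _ → _)
T-if-does⇔ true  (no ¬p)  = mk⇔ (λ ()) (λ (_ , p) → ¬p p)

T-if-isYes⇔ : {P : Set} (b : Bool) (P? : Dec P) → T (if b then isYes P? else false) ⇔ (T b × P)
T-if-isYes⇔ b P? = subst (λ c → T (if b then c else false) ⇔ _) (sym (isYes≗does P?)) (T-if-does⇔ b P?)

T-all-any⇔ : ∀ {r n} {Q : Fin r → Fin n → Set} (test : Fin r → Fin n → Bool) →
             (∀ j v → T (test j v) ⇔ Q j v) →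
             T (all (λ j → any (test j) (allFin n)) (allFin r)) ⇔ (∀ j → ∃ (Q j))
T-all-any⇔ {r} {n} {Q} test test⇔Q = mk⇔ to from
  where
  hits : Fin r → Bool
  hits j = any (test j) (allFin n)
  to : T (all hits (allFin r)) → ∀ j → ∃ (Q j)
  to t j = let v , tv = Any.satisfied (any⁻ (test j) (allFin n) (All.lookup (all⁺ hits (allFin r) t) (∈-allFin j)))
           in v , Equivalence.to (test⇔Q j v) tv
  from : (∀ j → ∃ (Q j)) → T (all hits (allFin r))
  from q = all⁻ hits {xs = allFin r} (All.tabulate λ {j} _ →
    let v , qv = q j in any⁺ (test j) (lose (∈-allFin v) (Equivalence.from (test⇔Q j v) qv)))

isCut⇔ : ∀ {r} (f : Cut n r) (e : Subset n) → T (isCut f e) ⇔ (∀ j → ∃ λ v → T (vlookup e v) × f v ≡ j)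
isCut⇔ f e = T-all-any⇔ _ λ j v → T-if-isYes⇔ (vlookup e v) (f v Fin.≟ j)

meetsAllNumbers⇔ : ∀ q r (σ : Fin n → Label q r) (e : Subset n) →
                   T (meetsAllNumbers q r σ e) ⇔ (∀ j → ∃ λ v → T (vlookup e v) × σ v ≡ just j)
meetsAllNumbers⇔ q r σ e = T-all-any⇔ _ λ j v → T-if-does⇔ (vlookup e v) (≡-dec Fin._≟_ (σ v) (just j))

isCut-cong : ∀ {r} {f g : Cut n r} → f ≗ g → ∀ e → isCut f e ≡ isCut g e
isCut-cong f≗g e = T-injective (mk⇔ (cut⇒cut f≗g) (cut⇒cut (sym ∘ f≗g)))
  where
  cut⇒cut : ∀ {f g} → f ≗ g → T (isCut f e) → T (isCut g e)
  cut⇒cut {f} {g} f≗g cut = Equivalence.from (isCut⇔ g e) λ j →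
    let v , ev , fv≡j = Equivalence.to (isCut⇔ f e) cut j in v , ev , trans (sym (f≗g v)) fv≡j

count : (X → Bool) → List X → ℕ
count p xs = length (filter (λ x → p x ≟ᵇ true) xs)

count-cong : {p p′ : X → Bool} (xs : List X) → (∀ x → p x ≡ p′ x) → count p xs ≡ count p′ xs
count-cong []       p≗p′ = refl
count-cong {p = p} {p′} (x ∷ xs) p≗p′ with p x | p′ x | p≗p′ x
... | true  | .true  | refl = cong suc (count-cong xs p≗p′)
... | false | .false | refl = count-cong xs p≗p′

count-map-filter : (b : X → Bool) (g : X → A) (p : A → Bool) (xs : List X) →
                   count p (map g (filter (λ x → b x ≟ᵇ true) xs)) ≡ count (λ x → b x ∧ p (g x)) xs
count-map-filter b g p []       = refl
count-map-filter b g p (x ∷ xs) with b x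
... | false = count-map-filter b g p xs
... | true with p (g x)
...   | true  = cong suc (count-map-filter b g p xs)
...   | false = count-map-filter b g p xs

cutSize-cong : ∀ {r} (E : MultiHypergraph n) {f g : Cut n r} → f ≗ g → cutSize E f ≡ cutSize E g
cutSize-cong E f≗g = count-cong E (isCut-cong f≗g)

surp-attained : ∀ q′ (E : MultiHypergraph n) → ∃ λ g → surp (suc q′) E ≡ surplus E g
surp-attained {n} q′ E =
  let g₀ , gs , allCuts≡ = allFuns-nonEmpty zero (tabulate suc) n
      g , max≡           = maxList-map-attained (surplus E) g₀ gs
  in g , trans (cong (maxList ∘ map (surplus E)) allCuts≡) max≡

isStar⇒≡nothing : ∀ {q r} (l : Label q r) → isStar q r l ≡ true → l ≡ nothing
isStar⇒≡nothing nothing _ = refl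

labelProb-nonNeg : ∀ q r .{{_ : ℕ.NonZero r}} (l : Label q r) → 0ℚ ≤ labelProb q r l
labelProb-nonNeg q r nothing  = nonNegative⁻¹ _ {{normalize-nonNeg q r}}
labelProb-nonNeg q r (just _) = nonNegative⁻¹ _ {{normalize-nonNeg 1 r}}

module Labelling (q′ r′ : ℕ) (q+k≡r : suc q′ ℕ.+ (suc r′ ∸ suc q′) ≡ suc r′) where

  q r k : ℕ
  q = suc q′
  r = suc r′
  k = r ∸ q

  encode : Fin q ⊎ Fin k → Fin r
  encode = cast q+k≡r ∘ join q k

  decode : Fin r → Fin q ⊎ Fin k
  decode = splitAt q ∘ cast (sym q+k≡r)

  decode-encode : ∀ x → decode (encode x) ≡ x
  decode-encode x =
    trans (cong (splitAt q) (Fin.cast-involutive (sym q+k≡r) q+k≡r (join q k x))) (Fin.splitAt-join q k x)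

  encode-decode : ∀ a → encode (decode a) ≡ a
  encode-decode a =
    trans (cong (cast q+k≡r) (Fin.join-splitAt q k (cast (sym q+k≡r) a))) (Fin.cast-involutive q+k≡r (sym q+k≡r) a)

  encode-injective : ∀ {x y} → encode x ≡ encode y → x ≡ y
  encode-injective {x} {y} ex≡ey = trans (sym (decode-encode x)) (trans (cong decode ex≡ey) (decode-encode y))

  -- The parts 0 … q-1 of an r-cut carry a q-cut of the starred vertices; the number q+1+j of
  -- a labelled vertex becomes its part q+j.
  part : Label q r → Fin q → Fin r
  part nothing  b = encode (inj₁ b)
  part (just j) _ = encode (inj₂ j)

  part-surjective : ∀ a → ∃₂ λ l b → part l b ≡ a
  part-surjective a with decode a in decode-a
  ... | inj₁ b = nothing , b    , trans (cong encode (sym decode-a)) (encode-decode a)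
  ... | inj₂ j = just j  , zero , trans (cong encode (sym decode-a)) (encode-decode a)

  part≡part-nothing : ∀ l {b b′} → part l b ≡ part nothing b′ → l ≡ nothing × b ≡ b′
  part≡part-nothing nothing  {b} {b′} eq with encode-injective {inj₁ b} {inj₁ b′} eq
  ... | refl = refl , refl
  part≡part-nothing (just j) {b′ = b′} eq with encode-injective {inj₂ j} {inj₁ b′} eq
  ... | ()

  part≡part-just : ∀ l {b b′ j} → part l b ≡ part (just j) b′ → l ≡ just j
  part≡part-just nothing  {b} {j = j} eq with encode-injective {inj₁ b} {inj₂ j} eq
  ... | ()
  part≡part-just (just j) {j = j′} eq with encode-injective {inj₂ j} {inj₂ j′} eq
  ... | refl = refl

  labels : List (Label q r)
  labels = nothing ∷ map just (allFin k)

  1/q 1/r : ℚ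
  1/q = + 1 / q
  1/r = + 1 / r

  1/q*q≡1 : 1/q * toℚ (length (allFin q)) ≡ 1ℚ
  1/q*q≡1 = 1/suc*length-allFin≡1 q′

  1/r*r≡1 : 1/r * toℚ (length (allFin r)) ≡ 1ℚ
  1/r*r≡1 = 1/suc*length-allFin≡1 r′

  ∑-allFin-encode : (G : Fin r → ℚ) →
                    ∑ (allFin r) G ≡ ∑[ b ∈ allFin q ] G (encode (inj₁ b)) + ∑[ j ∈ allFin k ] G (encode (inj₂ j))
  ∑-allFin-encode G = trans (∑-allFin-cast q+k≡r G) (∑-allFin-+ q k (G ∘ cast q+k≡r))

  ∑-labelProb-part : ∀ G → ∑[ l ∈ labels ] (labelProb q r l * (1/q * ∑[ b ∈ allFin q ] G (part l b)))
                             ≡ 1/r * ∑ (allFin r) G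
  ∑-labelProb-part G = begin
      + q / r * (1/q * ∑[ b ∈ allFin q ] G (part nothing b))
        + ∑[ l ∈ map just (allFin k) ] (labelProb q r l * (1/q * ∑[ b ∈ allFin q ] G (part l b)))
    ≡⟨ cong₂ _+_ starred (trans (∑-map just (allFin k) _) (∑-cong (allFin k) numbered)) ⟩
      1/r * ∑[ b ∈ allFin q ] G (encode (inj₁ b)) + ∑[ j ∈ allFin k ] (1/r * G (encode (inj₂ j)))
    ≡⟨ cong (_+_ (1/r * _)) (∑-*ˡ (allFin k) 1/r _) ⟩
      1/r * ∑[ b ∈ allFin q ] G (encode (inj₁ b)) + 1/r * ∑[ j ∈ allFin k ] G (encode (inj₂ j))
    ≡⟨ *-distribˡ-+ 1/r _ _ ⟨
      1/r * (∑[ b ∈ allFin q ] G (encode (inj₁ b)) + ∑[ j ∈ allFin k ] G (encode (inj₂ j)))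
    ≡⟨ cong (1/r *_) (∑-allFin-encode G) ⟨
      1/r * ∑ (allFin r) G
    ∎
    where
    open ≡-Reasoning
    cancel : ∀ x → 1/r * (1/q * (toℚ (length (allFin q)) * x)) ≡ 1/r * x
    cancel x = cong (1/r *_) (trans (sym (*-assoc 1/q _ x)) (trans (cong (_* x) 1/q*q≡1) (*-identityˡ x)))
    starred : + q / r * (1/q * ∑[ b ∈ allFin q ] G (part nothing b)) ≡ 1/r * ∑[ b ∈ allFin q ] G (encode (inj₁ b))
    starred = begin
        + q / r * (1/q * S)                          ≡⟨ cong (_* (1/q * S)) (/≡toℚ*1/ q r′) ⟩
        toℚ q * 1/r * (1/q * S)                      ≡⟨ solve 4 (λ t u v s → t :* u :* (v :* s) := u :* (v :* (t :* s)))
                                                              refl (toℚ q) 1/r 1/q S ⟩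
        1/r * (1/q * (toℚ q * S))                    ≡⟨ cong (λ l → 1/r * (1/q * (toℚ l * S))) (length-allFin q) ⟨
        1/r * (1/q * (toℚ (length (allFin q)) * S))  ≡⟨ cancel S ⟩
        1/r * S                                      ∎
      where
      S : ℚ
      S = ∑[ b ∈ allFin q ] G (part nothing b)
    numbered : ∀ j → 1/r * (1/q * ∑[ b ∈ allFin q ] G (part (just j) b)) ≡ 1/r * G (encode (inj₂ j))
    numbered j = trans (cong (λ s → 1/r * (1/q * s)) (∑-const (allFin q) _)) (cancel _)

  module _ {n : ℕ} (H : MultiHypergraph n) where
    open Tensorisation labels (allFin q) (allFin r) (labelProb q r) part 1/q 1/r ∑-labelProb-part

    cutCount : Cut n r → ℚ
    cutCount f = toℚ (cutSize H f)

    cutCount-cong : Congruent _≗_ _≡_ cutCount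
    cutCount-cong f≗g = cong toℚ (cutSize-cong H f≗g)

    module Restriction (σ : Fin n → Label q r) where
      open FilterThinning (filterThinning (λ v → isStar q r (σ v) ≟ᵇ true))

      embed-starred : ∀ i → σ (embed thinning i) ≡ nothing
      embed-starred i = isStar⇒≡nothing (σ (embed thinning i)) (embed-sound i)

      starred⇒embedded : ∀ {v} → σ v ≡ nothing → ∃ λ i → embed thinning i ≡ v
      starred⇒embedded σv≡* = embed-complete (cong (isStar q r) σv≡*)

      restrictEdge-embed : ∀ e i → vlookup (restrictEdge q r σ e) i ≡ vlookup e (embed thinning i)
      restrictEdge-embed e i = trans (Vec.lookup∘tabulate _ i) (cong (vlookup e) (lookup-filter i))

      isCut-merge : ∀ h e → isCut (zipWith part σ h) e
                            ≡ meetsAllNumbers q r σ e ∧ isCut (h ∘ embed thinning) (restrictEdge q r σ e)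
      isCut-merge h e = T-injective (mk⇔ split unsplit)
        where
        e′ : Subset (length (stars q r σ))
        e′ = restrictEdge q r σ e
        meets⇔ : T (meetsAllNumbers q r σ e) ⇔ (∀ j → ∃ λ v → T (vlookup e v) × σ v ≡ just j)
        meets⇔ = meetsAllNumbers⇔ q r σ e
        cut⇔ : T (isCut (zipWith part σ h) e) ⇔ (∀ a → ∃ λ v → T (vlookup e v) × part (σ v) (h v) ≡ a)
        cut⇔ = isCut⇔ (zipWith part σ h) e
        cut′⇔ : T (isCut (h ∘ embed thinning) e′) ⇔ (∀ b → ∃ λ i → T (vlookup e′ i) × h (embed thinning i) ≡ b)
        cut′⇔ = isCut⇔ (h ∘ embed thinning) e′
        ∧⇔ : T (meetsAllNumbers q r σ e ∧ isCut (h ∘ embed thinning) e′) ⇔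
             (T (meetsAllNumbers q r σ e) × T (isCut (h ∘ embed thinning) e′))
        ∧⇔ = T-∧

        split : T (isCut (zipWith part σ h) e) → T (meetsAllNumbers q r σ e ∧ isCut (h ∘ embed thinning) e′)
        split cut = Equivalence.from ∧⇔ (Equivalence.from meets⇔ numbered , Equivalence.from cut′⇔ starred)
          where
          numbered : ∀ j → ∃ λ v → T (vlookup e v) × σ v ≡ just j
          numbered j = let v , ev , part≡ = Equivalence.to cut⇔ cut (part (just j) zero)
                       in v , ev , part≡part-just (σ v) {b′ = zero} part≡
          starred : ∀ b → ∃ λ i → T (vlookup e′ i) × h (embed thinning i) ≡ b
          starred b = let v , ev , part≡ = Equivalence.to cut⇔ cut (part nothing b)
                          σv≡* , hv≡b   = part≡part-nothing (σ v) part≡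
                          i , embed-i≡v = starred⇒embedded σv≡*
                      in i , subst T (sym (trans (restrictEdge-embed e i) (cong (vlookup e) embed-i≡v))) ev
                           , trans (cong h embed-i≡v) hv≡b

        unsplit : T (meetsAllNumbers q r σ e ∧ isCut (h ∘ embed thinning) e′) → T (isCut (zipWith part σ h) e)
        unsplit meets∧cut = Equivalence.from cut⇔ λ a → hit a (part-surjective a)
          where
          hit : ∀ a → ∃₂ (λ l b → part l b ≡ a) → ∃ λ v → T (vlookup e v) × part (σ v) (h v) ≡ a
          hit a (nothing , b , part≡a) =
            let i , e′i , hi≡b = Equivalence.to cut′⇔ (proj₂ (Equivalence.to ∧⇔ meets∧cut)) b
            in embed thinning i , subst T (restrictEdge-embed e i) e′i
             , trans (cong₂ part (embed-starred i) hi≡b) part≡a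
          hit a (just j , b , part≡a) =
            let v , ev , σv≡j = Equivalence.to meets⇔ (proj₁ (Equivalence.to ∧⇔ meets∧cut)) j
            in v , ev , trans (cong (λ l → part l (h v)) σv≡j) part≡a

      cutSize-restrict : ∀ h → cutSize (Hσ q r H σ) (h ∘ embed thinning) ≡ cutSize H (zipWith part σ h)
      cutSize-restrict h =
        trans (count-map-filter (meetsAllNumbers q r σ) (restrictEdge q r σ) (isCut (h ∘ embed thinning)) H)
              (count-cong H λ e → sym (isCut-merge h e))

      expectedCutSize-Hσ :
        expectedCutSize q (Hσ q r H σ) ≡ 1/q ^ n * ∑[ h ∈ allFuns (allFin q) n ] cutCount (zipWith part σ h)
      expectedCutSize-Hσ = begin
          expectedCutSize q (Hσ q r H σ)
        ≡⟨ avg-allFuns 1/q (allFin q) 1/q*q≡1 (length (stars q r σ)) cutCountσ ⟩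
          1/q ^ length (stars q r σ) * ∑ (allCuts (length (stars q r σ)) q) cutCountσ
        ≡⟨ ∑-allFuns-∘embed 1/q (allFin q) 1/q*q≡1 thinning cutCountσ (cong toℚ ∘ cutSize-cong (Hσ q r H σ)) ⟨
          1/q ^ n * ∑[ h ∈ allFuns (allFin q) n ] cutCountσ (h ∘ embed thinning)
        ≡⟨ cong (1/q ^ n *_) (∑-cong (allFuns (allFin q) n) λ h → cong toℚ (cutSize-restrict h)) ⟩
          1/q ^ n * ∑[ h ∈ allFuns (allFin q) n ] cutCount (zipWith part σ h)
        ∎
        where
        open ≡-Reasoning
        cutCountσ : Cut (length (stars q r σ)) q → ℚ
        cutCountσ g = toℚ (cutSize (Hσ q r H σ) g)

      bestCut : ∃ λ g → surp q (Hσ q r H σ) ≡ surplus (Hσ q r H σ) g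
      bestCut = surp-attained q′ (Hσ q r H σ)

      mergedCut : Cut n r
      mergedCut = zipWith part σ (extend thinning zero (proj₁ bestCut))

      surp-Hσ≡ : surp q (Hσ q r H σ) ≡ cutCount mergedCut - expectedCutSize q (Hσ q r H σ)
      surp-Hσ≡ = trans (proj₂ bestCut) (cong (λ c → toℚ c - expectedCutSize q (Hσ q r H σ))
        (trans (cutSize-cong (Hσ q r H σ) (sym ∘ extend-embed thinning zero (proj₁ bestCut))) (cutSize-restrict _)))

    open Restriction public using (mergedCut)
    open Restriction using (expectedCutSize-Hσ; surp-Hσ≡)

    ∑σProb*expectedCutSize : ∑[ σ ∈ allLabellings n q r ] (σProb q r σ * expectedCutSize q (Hσ q r H σ))
                             ≡ expectedCutSize r H
    ∑σProb*expectedCutSize = begin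
        ∑[ σ ∈ allLabellings n q r ] (σProb q r σ * expectedCutSize q (Hσ q r H σ))
      ≡⟨ ∑-cong (allLabellings n q r) (λ σ → cong (σProb q r σ *_) (expectedCutSize-Hσ σ)) ⟩
        ∑ (allLabellings n q r) (weightedMean n cutCount)
      ≡⟨ tensorise n cutCount cutCount-cong ⟩
        1/r ^ n * ∑ (allCuts n r) cutCount
      ≡⟨ avg-allFuns 1/r (allFin r) 1/r*r≡1 n cutCount ⟨
        expectedCutSize r H
      ∎
      where open ≡-Reasoning

    ∑σProb≡1 : ∑ (allLabellings n q r) (σProb q r) ≡ 1ℚ
    ∑σProb≡1 = begin
        ∑ (allLabellings n q r) (σProb q r)
      ≡⟨ ∑-cong (allLabellings n q r) (λ σ → trans (sym (*-identityʳ _))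
           (cong (σProb q r σ *_) (sym (^*∑-allFuns-1≡1 1/q (allFin q) 1/q*q≡1 n)))) ⟩
        ∑ (allLabellings n q r) (weightedMean n (λ _ → 1ℚ))
      ≡⟨ tensorise n (λ _ → 1ℚ) (λ _ → refl) ⟩
        1/r ^ n * ∑[ f ∈ allCuts n r ] 1ℚ
      ≡⟨ ^*∑-allFuns-1≡1 1/r (allFin r) 1/r*r≡1 n ⟩
        1ℚ
      ∎
      where open ≡-Reasoning

    σProb-nonNeg : ∀ σ → 0ℚ ≤ σProb q r σ
    σProb-nonNeg σ = product-nonNeg (allFin n) (labelProb q r ∘ σ) (labelProb-nonNeg q r ∘ σ)

    expectedSurpHσ≡∑σProb*surplus :
      expectedSurpHσ q r H ≡ ∑[ σ ∈ allLabellings n q r ] (σProb q r σ * surplus H (mergedCut σ))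
    expectedSurpHσ≡∑σProb*surplus = begin
        ∑[ σ ∈ Λ ] (P σ * surp q (Hσ q r H σ))
      ≡⟨ ∑-cong Λ (λ σ → trans (cong (P σ *_) (surp-Hσ≡ σ)) (*-distribˡ-- (P σ) _ _)) ⟩
        ∑[ σ ∈ Λ ] (P σ * cutCount (mergedCut σ) - P σ * expectedCutSize q (Hσ q r H σ))
      ≡⟨ ∑-- Λ _ _ ⟩
        ∑[ σ ∈ Λ ] (P σ * cutCount (mergedCut σ)) - ∑[ σ ∈ Λ ] (P σ * expectedCutSize q (Hσ q r H σ))
      ≡⟨ cong (_-_ (∑[ σ ∈ Λ ] (P σ * cutCount (mergedCut σ))))
              (trans ∑σProb*expectedCutSize (sym ∑σProb*Er)) ⟩
        ∑[ σ ∈ Λ ] (P σ * cutCount (mergedCut σ)) - ∑[ σ ∈ Λ ] (P σ * Er)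
      ≡⟨ ∑-- Λ _ _ ⟨
        ∑[ σ ∈ Λ ] (P σ * cutCount (mergedCut σ) - P σ * Er)
      ≡⟨ ∑-cong Λ (λ σ → *-distribˡ-- (P σ) _ _) ⟨
        ∑[ σ ∈ Λ ] (P σ * surplus H (mergedCut σ))
      ∎
      where
      open ≡-Reasoning
      Λ : List (Fin n → Label q r)
      Λ = allLabellings n q r
      P : (Fin n → Label q r) → ℚ
      P = σProb q r
      Er : ℚ
      Er = expectedCutSize r H
      *-distribˡ-- : ∀ x y z → x * (y - z) ≡ x * y - x * z
      *-distribˡ-- = solve 3 (λ x y z → x :* (y :- z) := x :* y :- x :* z) refl
      ∑σProb*Er : ∑[ σ ∈ Λ ] (P σ * Er) ≡ Er
      ∑σProb*Er = trans (∑-cong Λ λ σ → *-comm (P σ) Er)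
                        (trans (∑-*ˡ Λ Er P) (trans (cong (Er *_) ∑σProb≡1) (*-identityʳ Er)))

lemma3p8 : (q r n : ℕ) → .{{_ : ℕ.NonZero r}} → 2 ℕ.≤ q → 2 ℕ.≤ r → q ℕ.≤ r ∸ 1 →
    (H : MultiHypergraph n) → Unique H →
    ∃ λ (f : Cut n r) → expectedSurpHσ q r H ≤ surplus H f
lemma3p8 (suc q′) (suc r′) n (ℕ.s≤s _) _ q≤r-1 H _ =
  let σ , mean≤ = ∃-weightedMean≤ (allLabellings n q r) (σProb q r) (surplus H ∘ mergedCut H)
                                   (σProb-nonNeg H) (∑σProb≡1 H)
  in mergedCut H σ , ≤-trans (≤-reflexive (expectedSurpHσ≡∑σProb*surplus H)) mean≤
  where open Labelling q′ r′ (ℕ.m+[n∸m]≡n (ℕ.≤-trans q≤r-1 (ℕ.n≤1+n r′)))
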